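{- For every Boolean function $f:\{0,1\}^n\to\{0,1\}$, $$\mathrm{Depth}(f)\le \mathrm{Rank}(f)\,\bigl(1+\log \mathrm{spar}(f)\bigr).$$ Moreover, the inequality is tight, as witnessed by the parity function $\mathrm{PARITY}_n(x)=x_1\oplus\cdots\oplus x_n$.
   Context: A (simple) decision tree for $f$ is a rooted binary tree whose internal nodes are labelled by variables $x_i$ (left branch for $x_i=0$, right for $x_i=1$) and whose leaves are labelled by $0/1$, such that on every input the leaf reached is labelled $f(x)$. $\mathrm{Depth}(f)$ is the minimum depth (length of longest root-to-leaf path) of a decision tree computing $f$. The rank of a rooted binary tree is defined recursively: a leaf has rank $0$; an internal node with children of ranks $a,b$ has rank $a+1$ if $a=b$ and $\max\{a,b\}$ otherwise; the rank of the tree is the rank of its root. $\mathrm{Rank}(f)$ is the minimum rank of a decision tree computing $f$. Every $f:\{0,1\}^n\to\mathbb{R}$ has a unique expansion $f=\sum_{S\subseteq[n]}\hat f(S)\chi_S$ with $\chi_S(x)=(-1)^{\sum_{i\in S}x_i}$; $\mathrm{spar}(f)=|\{S:\hat f(S)\ne 0\}|$. Logarithms are base 2. -}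

module Defs where

open import Data.Bool using (Bool; true; false; if_then_else_; _∧_; _xor_)
open import Data.Nat using (ℕ; zero; suc; _+_; _⊔_; _≤_)
open import Data.Fin using (Fin)
open import Data.Vec using (Vec; []; _∷_; lookup; zipWith; foldr)
open import Data.List using (List; []; _∷_; map; _++_; filter; length)
import Data.List as List
open import Data.Integer using (ℤ; +_; -_; _≟_)
import Data.Integer as ℤ
open import Data.Product using (Σ; _×_; _,_)
open import Relation.Nullary using (¬?)
open import Relation.Binary.PropositionalEquality using (_≡_)

-- Boolean functions {0,1}^n → {0,1}  (false = 0, true = 1)
BoolFun : ℕ → Set
BoolFun n = Vec Bool n → Bool

data DTree (n : ℕ) : Set where
  leaf : Bool → DTree n
  node : Fin n → DTree n → DTree n → DTree n   -- node i (branch x_i = 0) (branch x_i = 1)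

eval : ∀ {n} → DTree n → Vec Bool n → Bool
eval (leaf b)     x = b
eval (node i l r) x = if lookup x i then eval r x else eval l x

depth : ∀ {n} → DTree n → ℕ
depth (leaf _)     = 0
depth (node _ l r) = suc (depth l ⊔ depth r)

rankCombine : ℕ → ℕ → ℕ
rankCombine a b with a Data.Nat.≟ b
... | Relation.Nullary.yes _ = suc a
... | Relation.Nullary.no  _ = a ⊔ b

rank : ∀ {n} → DTree n → ℕ
rank (leaf _)     = 0
rank (node _ l r) = rankCombine (rank l) (rank r)

Computes : ∀ {n} → DTree n → BoolFun n → Set
Computes t f = ∀ x → eval t x ≡ f x

IsDepth : ∀ {n} → BoolFun n → ℕ → Set
IsDepth {n} f d =
  Σ (DTree n) (λ t → Computes t f × depth t ≡ d) ×
  (∀ (t : DTree n) → Computes t f → d ≤ depth t)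

IsRank : ∀ {n} → BoolFun n → ℕ → Set
IsRank {n} f r =
  Σ (DTree n) (λ t → Computes t f × rank t ≡ r) ×
  (∀ (t : DTree n) → Computes t f → r ≤ rank t)

allInputs : (n : ℕ) → List (Vec Bool n)
allInputs zero    = [] ∷ []
allInputs (suc n) = map (false ∷_) (allInputs n) ++ map (true ∷_) (allInputs n)

xorAll : ∀ {n} → Vec Bool n → Bool
xorAll = foldr _ _xor_ false

-- χ_S(x) = (-1)^{Σ_{i∈S} x_i}, with S given by its indicator vector
χ : ∀ {n} → Vec Bool n → Vec Bool n → ℤ
χ S x = if xorAll (zipWith _∧_ S x) then - (+ 1) else + 1

-- 2^n · \hat f(S) = Σ_x f(x) χ_S(x)  (f viewed as 0/1-valued)
scaledFourier : ∀ {n} → BoolFun n → Vec Bool n → ℤ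
scaledFourier {n} f S =
  List.foldr ℤ._+_ (+ 0) (map (λ x → if f x then χ S x else + 0) (allInputs n))

spar : ∀ {n} → BoolFun n → ℕ
spar {n} f = length (filter (λ S → ¬? (scaledFourier f S ≟ + 0)) (allInputs n))

PARITY : (n : ℕ) → BoolFun n
PARITY n = xorAll

-- Sparsity is computed by the Walsh–Hadamard butterfly F ↦ (F₀ + F₁ , F₀ − F₁) on the first
-- variable, which makes it amenable to induction over the coordinates. The key fact is a halving
-- lemma: if fixing some variables of f to the values A makes f the constant c, then fixing the
-- same variables to any other values B leaves at most (spar f + [c ≠ 0]) / 2 nonzero
-- coefficients, because coefficientwise 2h = (g + h) − (g − h).
-- Given a tree of rank r for f, follow it from the root, always into a child of smaller rank:
-- this path queries at most r variables and ends in a leaf, so fixing them as the path does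
-- makes f constant. Querying these variables and recursing on the answers therefore halves the
-- sparsity at the price of r queries, and once the sparsity is at most 1 the function is
-- constant. Hence Depth f ≤ r ⌈log spar f⌉, that is 2 ^ Depth f ≤ (2 spar f) ^ r.
-- For parity the same path has to fix every variable, since parity is constant on no subcube,
-- so its rank is n; the tree querying all variables has depth n, and the nonzero Walsh
-- coefficients are those of ∅ and of [n].
module Submission where

open import Defs
open import Data.Nat using (ℕ; suc; _+_; _*_; _^_; _≤_)
open import Data.Product using (_×_)
open import Relation.Binary.PropositionalEquality using (_≡_)

open import Data.Bool using (Bool; true; false; not; if_then_else_; _xor_; _∧_)
open import Data.Bool.Properties
  using (not-¬; not-distribˡ-xor; not-distribʳ-xor; xor-assoc; xor-same; xor-identityʳ)
open import Data.Fin as Fin using (Fin)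
import Data.Fin.Properties as Finₚ
open import Data.Integer as ℤ using (ℤ; 0ℤ; 1ℤ; -1ℤ)
import Data.Integer.Properties as ℤ
open import Data.Integer.Tactic.RingSolver using (solve-∀)
open import Data.List as List using (List; []; _∷_; _++_; map; filter; length)
open import Data.List.Membership.Propositional using (_∈_)
import Data.List.Properties as List
open import Data.List.Relation.Unary.Any as Any using (here; there)
open import Data.Nat using (zero; z≤n; s≤s; _⊔_; _≟_; _≤?_)
open import Data.Nat.ListAction using (sum)
open import Data.Nat.ListAction.Properties using (sum-++)
open import Data.Nat.Properties
open import Algebra.Properties.CommutativeSemigroup +-commutativeSemigroup
  using () renaming (interchange to +-interchange)
import Data.Nat.Tactic.RingSolver as ℕ-Solver
open import Data.Product using (_,_; ∃; proj₁; proj₂)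
open import Data.Sum using ([_,_]′)
open import Data.Vec as Vec using (Vec; []; _∷_; lookup; replicate; zipWith; tail; allFin; _[_]≔_)
import Data.Vec.Properties as Vecₚ
open import Function using (_∘_; const)
open import Relation.Binary.PropositionalEquality
  using (refl; sym; trans; cong; cong₂; subst; subst₂; _≗_; _≢_; module ≡-Reasoning)
open import Relation.Nullary using (yes; no; ¬?; contradiction)

private variable n : ℕ

-- Sparsity through the Walsh–Hadamard butterfly

IntFun : ℕ → Set
IntFun n = Vec Bool n → ℤ

toℤ : Bool → ℤ
toℤ b = if b then 1ℤ else 0ℤ

infixl 6 _⊕_ _⊖_
infixr 7 _·_

_⊕_ _⊖_ : IntFun n → IntFun n → IntFun n
(F ⊕ G) x = F x ℤ.+ G x
(F ⊖ G) x = F x ℤ.- G x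

_·_ : ℤ → IntFun n → IntFun n
(k · F) x = k ℤ.* F x

cofactor : Bool → IntFun (suc n) → IntFun n
cofactor b F x = F (b ∷ x)

-- Twice the even and odd parts of F with respect to its first variable.
evenPart oddPart : IntFun (suc n) → IntFun n
evenPart F = cofactor false F ⊕ cofactor true F
oddPart  F = cofactor false F ⊖ cofactor true F

nonZero : ℤ → ℕ
nonZero (ℤ.+ zero)  = 0
nonZero (ℤ.+ suc _) = 1
nonZero ℤ.-[1+ _ ]  = 1

-- The number of nonzero Walsh coefficients of F (sum-nonZero-walsh), computed by the
-- butterfly recursion of the fast Walsh–Hadamard transform.
sparsity : IntFun n → ℕ
sparsity {zero}  F = nonZero (F [])
sparsity {suc n} F = sparsity (evenPart F) + sparsity (oddPart F)

nonZero≤1 : ∀ z → nonZero z ≤ 1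
nonZero≤1 (ℤ.+ zero)  = z≤n
nonZero≤1 (ℤ.+ suc _) = ≤-refl
nonZero≤1 ℤ.-[1+ _ ]  = ≤-refl

≢0⇒nonZero≡1 : ∀ {z} → z ≢ 0ℤ → nonZero z ≡ 1
≢0⇒nonZero≡1 {ℤ.+ zero}    z≢0 = contradiction refl z≢0
≢0⇒nonZero≡1 {ℤ.+ suc _}   _   = refl
≢0⇒nonZero≡1 {ℤ.-[1+ _ ]} _   = refl

nonZero-* : ∀ {k} → k ≢ 0ℤ → ∀ z → nonZero (k ℤ.* z) ≡ nonZero z
nonZero-* {k} k≢0 z with z ℤ.≟ 0ℤ
... | yes refl = cong nonZero (ℤ.*-zeroʳ k)
... | no  z≢0  = trans (≢0⇒nonZero≡1 kz≢0) (sym (≢0⇒nonZero≡1 z≢0))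
  where kz≢0 : k ℤ.* z ≢ 0ℤ
        kz≢0 kz≡0 = [ k≢0 , z≢0 ]′ (ℤ.i*j≡0⇒i≡0∨j≡0 k kz≡0)

nonZero-+ : ∀ a b → nonZero (a ℤ.+ b) ≤ nonZero a + nonZero b
nonZero-+ a b with a ℤ.≟ 0ℤ | b ℤ.≟ 0ℤ
... | yes refl | _        = ≤-reflexive (cong nonZero (ℤ.+-identityˡ b))
... | no  _    | yes refl =
  ≤-trans (≤-reflexive (cong nonZero (ℤ.+-identityʳ a))) (m≤m+n (nonZero a) 0)
... | no  a≢0  | no  _    =
  ≤-trans (nonZero≤1 (a ℤ.+ b)) (≤-trans (≤-reflexive (sym (≢0⇒nonZero≡1 a≢0))) (m≤m+n _ _))

nonZero-double : ∀ z → nonZero (z ℤ.+ z) ≡ nonZero z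
nonZero-double z = trans (cong nonZero (double z)) (nonZero-* {ℤ.+ 2} (λ ()) z)
  where double : ∀ z → z ℤ.+ z ≡ ℤ.+ 2 ℤ.* z
        double = solve-∀

nonZero-neg : ∀ z → nonZero (ℤ.- z) ≡ nonZero z
nonZero-neg (ℤ.+ zero)  = refl
nonZero-neg (ℤ.+ suc _) = refl
nonZero-neg ℤ.-[1+ _ ]  = refl

nonZero≤butterfly : ∀ g h → nonZero h ≤ nonZero (g ℤ.+ h) + nonZero (g ℤ.- h)
nonZero≤butterfly g h = begin
  nonZero h                                      ≡⟨ nonZero-double h ⟨
  nonZero (h ℤ.+ h)                              ≡⟨ cong nonZero (butterfly g h) ⟩
  nonZero ((g ℤ.+ h) ℤ.+ ℤ.- (g ℤ.- h))          ≤⟨ nonZero-+ (g ℤ.+ h) (ℤ.- (g ℤ.- h)) ⟩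
  nonZero (g ℤ.+ h) + nonZero (ℤ.- (g ℤ.- h))    ≡⟨ cong (λ k → nonZero (g ℤ.+ h) + k) (nonZero-neg (g ℤ.- h)) ⟩
  nonZero (g ℤ.+ h) + nonZero (g ℤ.- h)          ∎
  where
  open ≤-Reasoning
  butterfly : ∀ g h → h ℤ.+ h ≡ (g ℤ.+ h) ℤ.+ ℤ.- (g ℤ.- h)
  butterfly = solve-∀

nonZero-pair : ∀ g h → 2 * nonZero h ≤ nonZero (g ℤ.+ h) + nonZero (g ℤ.- h) + nonZero g
nonZero-pair g h with g ℤ.≟ 0ℤ
... | yes refl = ≤-reflexive (begin
  2 * nonZero h                                     ≡⟨ cong (nonZero h +_) (+-identityʳ (nonZero h)) ⟩
  nonZero h + nonZero h                             ≡⟨ cong₂ _+_ (cong nonZero (ℤ.+-identityˡ h))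
                                                                 (trans (cong nonZero (ℤ.+-identityˡ (ℤ.- h)))
                                                                        (nonZero-neg h)) ⟨
  nonZero (0ℤ ℤ.+ h) + nonZero (0ℤ ℤ.- h)           ≡⟨ +-identityʳ _ ⟨
  nonZero (0ℤ ℤ.+ h) + nonZero (0ℤ ℤ.- h) + 0       ∎)
  where open ≡-Reasoning
... | no g≢0 = begin
  2 * nonZero h                                     ≡⟨ cong (nonZero h +_) (+-identityʳ (nonZero h)) ⟩
  nonZero h + nonZero h                             ≤⟨ +-mono-≤ (nonZero≤butterfly g h) (nonZero≤1 h) ⟩
  nonZero (g ℤ.+ h) + nonZero (g ℤ.- h) + 1         ≡⟨ cong (nonZero (g ℤ.+ h) + nonZero (g ℤ.- h) +_)
                                                            (≢0⇒nonZero≡1 g≢0) ⟨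
  nonZero (g ℤ.+ h) + nonZero (g ℤ.- h) + nonZero g ∎
  where open ≤-Reasoning

module _ {n} (F G : IntFun (suc n)) where

  private
    F₀ = cofactor false F ; F₁ = cofactor true F
    G₀ = cofactor false G ; G₁ = cofactor true G

  evenPart-⊕ : evenPart (F ⊕ G) ≗ evenPart F ⊕ evenPart G
  evenPart-⊕ x = regroup (F₀ x) (G₀ x) (F₁ x) (G₁ x)
    where regroup : ∀ a b c d → (a ℤ.+ b) ℤ.+ (c ℤ.+ d) ≡ (a ℤ.+ c) ℤ.+ (b ℤ.+ d)
          regroup = solve-∀

  oddPart-⊕ : oddPart (F ⊕ G) ≗ oddPart F ⊕ oddPart G
  oddPart-⊕ x = regroup (F₀ x) (G₀ x) (F₁ x) (G₁ x)
    where regroup : ∀ a b c d → (a ℤ.+ b) ℤ.- (c ℤ.+ d) ≡ (a ℤ.- c) ℤ.+ (b ℤ.- d)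
          regroup = solve-∀

  evenPart-⊖ : evenPart (F ⊖ G) ≗ evenPart F ⊖ evenPart G
  evenPart-⊖ x = regroup (F₀ x) (G₀ x) (F₁ x) (G₁ x)
    where regroup : ∀ a b c d → (a ℤ.- b) ℤ.+ (c ℤ.- d) ≡ (a ℤ.+ c) ℤ.- (b ℤ.+ d)
          regroup = solve-∀

  oddPart-⊖ : oddPart (F ⊖ G) ≗ oddPart F ⊖ oddPart G
  oddPart-⊖ x = regroup (F₀ x) (G₀ x) (F₁ x) (G₁ x)
    where regroup : ∀ a b c d → (a ℤ.- b) ℤ.- (c ℤ.- d) ≡ (a ℤ.- c) ℤ.- (b ℤ.- d)
          regroup = solve-∀

evenPart-· : ∀ k (F : IntFun (suc n)) → evenPart (k · F) ≗ k · evenPart F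
evenPart-· k F x = sym (ℤ.*-distribˡ-+ k (F (false ∷ x)) (F (true ∷ x)))

oddPart-· : ∀ k (F : IntFun (suc n)) → oddPart (k · F) ≗ k · oddPart F
oddPart-· k F x = distrib k (F (false ∷ x)) (F (true ∷ x))
  where distrib : ∀ k a b → k ℤ.* a ℤ.- k ℤ.* b ≡ k ℤ.* (a ℤ.- b)
        distrib = solve-∀

sparsity-cong : ∀ {F G : IntFun n} → F ≗ G → sparsity F ≡ sparsity G
sparsity-cong {zero}  F≗G = cong nonZero (F≗G [])
sparsity-cong {suc n} F≗G = cong₂ _+_
  (sparsity-cong λ x → cong₂ ℤ._+_ (F≗G (false ∷ x)) (F≗G (true ∷ x)))
  (sparsity-cong λ x → cong₂ ℤ._-_ (F≗G (false ∷ x)) (F≗G (true ∷ x)))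

sparsity-⊕-split : (G H : IntFun (suc n)) →
  sparsity (G ⊕ H) ≡ sparsity (evenPart G ⊕ evenPart H) + sparsity (oddPart G ⊕ oddPart H)
sparsity-⊕-split G H = cong₂ _+_ (sparsity-cong (evenPart-⊕ G H)) (sparsity-cong (oddPart-⊕ G H))

sparsity-⊖-split : (G H : IntFun (suc n)) →
  sparsity (G ⊖ H) ≡ sparsity (evenPart G ⊖ evenPart H) + sparsity (oddPart G ⊖ oddPart H)
sparsity-⊖-split G H = cong₂ _+_ (sparsity-cong (evenPart-⊖ G H)) (sparsity-cong (oddPart-⊖ G H))

sparsity-const : ∀ k → sparsity {n} (const k) ≡ nonZero k
sparsity-const {zero}  k = refl
sparsity-const {suc n} k = begin
  sparsity {n = n} (const (k ℤ.+ k)) + sparsity {n = n} (const (k ℤ.- k))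
    ≡⟨ cong₂ _+_ (sparsity-const {n = n} (k ℤ.+ k)) (sparsity-const {n = n} (k ℤ.- k)) ⟩
  nonZero (k ℤ.+ k) + nonZero (k ℤ.- k)
    ≡⟨ cong₂ _+_ (nonZero-double k) (cong nonZero (ℤ.+-inverseʳ k)) ⟩
  nonZero k + 0
    ≡⟨ +-identityʳ (nonZero k) ⟩
  nonZero k ∎
  where open ≡-Reasoning

sparsity-· : ∀ {k} → k ≢ 0ℤ → (F : IntFun n) → sparsity (k · F) ≡ sparsity F
sparsity-· {zero}  k≢0 F = nonZero-* k≢0 (F [])
sparsity-· {suc n} {k} k≢0 F = cong₂ _+_
  (trans (sparsity-cong (evenPart-· k F)) (sparsity-· k≢0 (evenPart F)))
  (trans (sparsity-cong (oddPart-· k F)) (sparsity-· k≢0 (oddPart F)))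

sparsity-⊕ : (F G : IntFun n) → sparsity (F ⊕ G) ≤ sparsity F + sparsity G
sparsity-⊕ {zero}  F G = nonZero-+ (F []) (G [])
sparsity-⊕ {suc n} F G = begin
  sparsity (F ⊕ G)
    ≡⟨ sparsity-⊕-split F G ⟩
  sparsity (evenPart F ⊕ evenPart G) + sparsity (oddPart F ⊕ oddPart G)
    ≤⟨ +-mono-≤ (sparsity-⊕ (evenPart F) (evenPart G)) (sparsity-⊕ (oddPart F) (oddPart G)) ⟩
  (sparsity (evenPart F) + sparsity (evenPart G)) + (sparsity (oddPart F) + sparsity (oddPart G))
    ≡⟨ +-interchange (sparsity (evenPart F)) _ _ _ ⟩
  sparsity F + sparsity G ∎
  where open ≤-Reasoning

sparsity-⊕-self : (F : IntFun n) → sparsity (F ⊕ F) ≡ sparsity F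
sparsity-⊕-self F = trans (sparsity-cong (double ∘ F)) (sparsity-· {k = ℤ.+ 2} (λ ()) F)
  where double : ∀ z → z ℤ.+ z ≡ ℤ.+ 2 ℤ.* z
        double = solve-∀

sparsity-⊖-self : (F : IntFun n) → sparsity (F ⊖ F) ≡ 0
sparsity-⊖-self {n} F = trans (sparsity-cong (ℤ.+-inverseʳ ∘ F)) (sparsity-const {n = n} 0ℤ)

sparsity-cofactor : ∀ β (F : IntFun (suc n)) → sparsity (cofactor β F) ≤ sparsity F
sparsity-cofactor β F = begin
  sparsity (cofactor β F)                     ≡⟨ sparsity-⊕-self (cofactor β F) ⟨
  sparsity (cofactor β F ⊕ cofactor β F)      ≡⟨ sparsity-cong (recover β) ⟩
  sparsity (evenPart F ⊕ sign β · oddPart F)  ≤⟨ sparsity-⊕ (evenPart F) (sign β · oddPart F) ⟩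
  sparsity (evenPart F) + sparsity (sign β · oddPart F)
                                              ≡⟨ cong (λ s → sparsity (evenPart F) + s)
                                                      (sparsity-· (sign≢0 β) (oddPart F)) ⟩
  sparsity F                                  ∎
  where
  open ≤-Reasoning
  sign : Bool → ℤ
  sign false = 1ℤ
  sign true  = -1ℤ
  sign≢0 : ∀ β → sign β ≢ 0ℤ
  sign≢0 false ()
  sign≢0 true  ()
  recover : ∀ β → cofactor β F ⊕ cofactor β F ≗ evenPart F ⊕ sign β · oddPart F
  recover false x = regroup (F (false ∷ x)) (F (true ∷ x))
    where regroup : ∀ a b → a ℤ.+ a ≡ (a ℤ.+ b) ℤ.+ 1ℤ ℤ.* (a ℤ.- b)
          regroup = solve-∀
  recover true x = regroup (F (false ∷ x)) (F (true ∷ x))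
    where regroup : ∀ a b → b ℤ.+ b ≡ (a ℤ.+ b) ℤ.+ -1ℤ ℤ.* (a ℤ.- b)
          regroup = solve-∀

flipFirst : IntFun (suc n) → IntFun (suc n)
flipFirst H (b ∷ x) = H (not b ∷ x)

-- Flipping the first variable of H exchanges the odd parts of G ⊕ H and G ⊖ H.
sparsity-flipFirst : (G H : IntFun (suc n)) →
  sparsity (G ⊕ flipFirst H) + sparsity (G ⊖ flipFirst H) ≡ sparsity (G ⊕ H) + sparsity (G ⊖ H)
sparsity-flipFirst G H = begin
  (sparsity (evenPart (G ⊕ flipFirst H)) + sparsity (oddPart (G ⊕ flipFirst H))) +
  (sparsity (evenPart (G ⊖ flipFirst H)) + sparsity (oddPart (G ⊖ flipFirst H)))
    ≡⟨ cong₂ _+_ (cong₂ _+_ (sparsity-cong (quarters even-⊕)) (sparsity-cong (quarters odd-⊕)))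
                 (cong₂ _+_ (sparsity-cong (quarters even-⊖)) (sparsity-cong (quarters odd-⊖))) ⟩
  (sparsity (evenPart (G ⊕ H)) + sparsity (oddPart (G ⊖ H))) +
  (sparsity (evenPart (G ⊖ H)) + sparsity (oddPart (G ⊕ H)))
    ≡⟨ swap (sparsity (evenPart (G ⊕ H))) _ (sparsity (evenPart (G ⊖ H))) _ ⟩
  (sparsity (evenPart (G ⊕ H)) + sparsity (oddPart (G ⊕ H))) +
  (sparsity (evenPart (G ⊖ H)) + sparsity (oddPart (G ⊖ H))) ∎
  where
  open ≡-Reasoning
  quarters : {P Q : ℤ → ℤ → ℤ → ℤ → ℤ} → (∀ a b c d → P a b c d ≡ Q a b c d) →
             (λ x → P (G (false ∷ x)) (G (true ∷ x)) (H (false ∷ x)) (H (true ∷ x))) ≗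
             (λ x → Q (G (false ∷ x)) (G (true ∷ x)) (H (false ∷ x)) (H (true ∷ x)))
  quarters P≡Q x = P≡Q _ _ _ _
  even-⊕ : ∀ a b c d → (a ℤ.+ d) ℤ.+ (b ℤ.+ c) ≡ (a ℤ.+ c) ℤ.+ (b ℤ.+ d)
  even-⊕ = solve-∀
  odd-⊕ : ∀ a b c d → (a ℤ.+ d) ℤ.- (b ℤ.+ c) ≡ (a ℤ.- c) ℤ.- (b ℤ.- d)
  odd-⊕ = solve-∀
  even-⊖ : ∀ a b c d → (a ℤ.- d) ℤ.+ (b ℤ.- c) ≡ (a ℤ.- c) ℤ.+ (b ℤ.- d)
  even-⊖ = solve-∀
  odd-⊖ : ∀ a b c d → (a ℤ.- d) ℤ.- (b ℤ.- c) ≡ (a ℤ.+ c) ℤ.- (b ℤ.+ d)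
  odd-⊖ = solve-∀
  swap : ∀ a b c d → (a + b) + (c + d) ≡ (a + d) + (c + b)
  swap = ℕ-Solver.solve-∀

sparsity-cofactor-both : ∀ β (G H : IntFun (suc n)) →
  sparsity (cofactor β G ⊕ cofactor β H) + sparsity (cofactor β G ⊖ cofactor β H) ≤
  sparsity (G ⊕ H) + sparsity (G ⊖ H)
sparsity-cofactor-both β G H = +-mono-≤ (sparsity-cofactor β (G ⊕ H)) (sparsity-cofactor β (G ⊖ H))

sparsity-cofactor-pair : ∀ β γ (G H : IntFun (suc n)) →
  sparsity (cofactor β G ⊕ cofactor γ H) + sparsity (cofactor β G ⊖ cofactor γ H) ≤
  sparsity (G ⊕ H) + sparsity (G ⊖ H)
sparsity-cofactor-pair false false G H = sparsity-cofactor-both false G H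
sparsity-cofactor-pair true  true  G H = sparsity-cofactor-both true G H
sparsity-cofactor-pair false true  G H =
  ≤-trans (sparsity-cofactor-both false G (flipFirst H)) (≤-reflexive (sparsity-flipFirst G H))
sparsity-cofactor-pair true  false G H =
  ≤-trans (sparsity-cofactor-both true G (flipFirst H)) (≤-reflexive (sparsity-flipFirst G H))

bits-agree : ∀ a b → nonZero (toℤ a ℤ.+ toℤ b) + nonZero (toℤ a ℤ.- toℤ b) ≤ 1 → a ≡ b
bits-agree false false _ = refl
bits-agree true  true  _ = refl
bits-agree false true  (s≤s ())
bits-agree true  false (s≤s ())

sparsity≤1⇒constant : (h : Vec Bool n → Bool) → sparsity (toℤ ∘ h) ≤ 1 → ∀ x y → h x ≡ h y
sparsity≤1⇒constant {zero}  h _ [] [] = refl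
sparsity≤1⇒constant {suc n} h sp≤1 (a ∷ x) (b ∷ y) = begin
  h (a ∷ x)      ≡⟨ cofactor-constant a x z ⟩
  h (a ∷ z)      ≡⟨ trans (toFalse a) (sym (toFalse b)) ⟩
  h (b ∷ z)      ≡⟨ cofactor-constant b z y ⟩
  h (b ∷ y)      ∎
  where
  open ≡-Reasoning
  z = replicate n false
  cofactor-constant : ∀ β x y → h (β ∷ x) ≡ h (β ∷ y)
  cofactor-constant β = sparsity≤1⇒constant (h ∘ (β ∷_)) (≤-trans (sparsity-cofactor β (toℤ ∘ h)) sp≤1)
  h₀ = toℤ (h (false ∷ z)) ; h₁ = toℤ (h (true ∷ z))
  heads : h (false ∷ z) ≡ h (true ∷ z)
  heads = bits-agree _ _ (≤-trans (≤-reflexive (begin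
    nonZero (h₀ ℤ.+ h₁) + nonZero (h₀ ℤ.- h₁)
      ≡⟨ cong₂ _+_ (sparsity-const {n = n} (h₀ ℤ.+ h₁)) (sparsity-const {n = n} (h₀ ℤ.- h₁)) ⟨
    sparsity {n = n} (const (h₀ ℤ.+ h₁)) + sparsity {n = n} (const (h₀ ℤ.- h₁))
      ≡⟨ cong₂ _+_ (sparsity-cong λ x → cong₂ ℤ._+_ (toℤ-cofactor false x) (toℤ-cofactor true x))
                   (sparsity-cong λ x → cong₂ ℤ._-_ (toℤ-cofactor false x) (toℤ-cofactor true x)) ⟨
    sparsity (toℤ ∘ h) ∎)) sp≤1)
    where toℤ-cofactor : ∀ β x → toℤ (h (β ∷ x)) ≡ toℤ (h (β ∷ z))
          toℤ-cofactor β x = cong toℤ (cofactor-constant β x z)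
  toFalse : ∀ a → h (a ∷ z) ≡ h (false ∷ z)
  toFalse false = refl
  toFalse true  = sym heads

-- Restrictions

-- A restriction is encoded by a mask D of fixed coordinates together with their values A.
override : (D A x : Vec Bool n) → Vec Bool n
override []      []      []       = []
override (d ∷ D) (a ∷ A) (x ∷ xs) = (if d then a else x) ∷ override D A xs

lookup-override : (D A x : Vec Bool n) (i : Fin n) →
  lookup (override D A x) i ≡ (if lookup D i then lookup A i else lookup x i)
lookup-override (d ∷ D) (a ∷ A) (x ∷ xs) Fin.zero    = refl
lookup-override (d ∷ D) (a ∷ A) (x ∷ xs) (Fin.suc i) = lookup-override D A xs i

lookup-ext : {u v : Vec Bool n} → (∀ i → lookup u i ≡ lookup v i) → u ≡ v
lookup-ext {u = u} {v} u≗v =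
  trans (sym (Vecₚ.tabulate∘lookup u)) (trans (Vecₚ.tabulate-cong u≗v) (Vecₚ.tabulate∘lookup v))

override-none : (A x : Vec Bool n) → override (replicate n false) A x ≡ x
override-none []      []      = refl
override-none (a ∷ A) (x ∷ xs) = cong (x ∷_) (override-none A xs)

override-fixed : (D A x : Vec Bool n) {i : Fin n} → lookup D i ≡ true →
  lookup (override D A x) i ≡ lookup A i
override-fixed D A x {i} Dᵢ =
  trans (lookup-override D A x i) (cong (λ d → if d then lookup A i else lookup x i) Dᵢ)

override-absorb : ∀ {D A D′ B} → (∀ i → lookup D i ≡ true → lookup D′ i ≡ true) →
  (∀ i → lookup D i ≡ true → lookup B i ≡ lookup A i) →
  (x : Vec Bool n) → override D A (override D′ B x) ≡ override D′ B x
override-absorb {D = D} {A} {D′} {B} D⊆D′ B≈A x =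
  lookup-ext λ i → trans (lookup-override D A y i) (pointwise i)
  where
  y = override D′ B x
  pointwise : ∀ i → (if lookup D i then lookup A i else lookup y i) ≡ lookup y i
  pointwise i with lookup D i in Dᵢ
  ... | true  = sym (trans (override-fixed D′ B x (D⊆D′ i Dᵢ)) (B≈A i Dᵢ))
  ... | false = refl

override-refine : ∀ {D A D′} → (∀ i → lookup D i ≡ true → lookup D′ i ≡ true) → (y x : Vec Bool n) →
  (∀ i → lookup D′ i ≡ true → lookup D i ≡ false → lookup y i ≡ lookup x i) →
  override D′ (override D A y) x ≡ override D A x
override-refine {D = D} {A} {D′} D⊆D′ y x y≈x = lookup-ext λ i → begin
  lookup (override D′ (override D A y) x) i
    ≡⟨ lookup-override D′ (override D A y) x i ⟩
  (if lookup D′ i then lookup (override D A y) i else lookup x i)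
    ≡⟨ cong (λ v → if lookup D′ i then v else lookup x i) (lookup-override D A y i) ⟩
  (if lookup D′ i then (if lookup D i then lookup A i else lookup y i) else lookup x i)
    ≡⟨ cases i ⟩
  (if lookup D i then lookup A i else lookup x i)
    ≡⟨ lookup-override D A x i ⟨
  lookup (override D A x) i ∎
  where
  open ≡-Reasoning
  cases : ∀ i → (if lookup D′ i then (if lookup D i then lookup A i else lookup y i) else lookup x i) ≡
                (if lookup D i then lookup A i else lookup x i)
  cases i with lookup D i in Dᵢ | lookup D′ i in D′ᵢ
  ... | true  | true  = refl
  ... | true  | false = contradiction (trans (sym (D⊆D′ i Dᵢ)) D′ᵢ) λ ()
  ... | false | true  = y≈x i D′ᵢ Dᵢ
  ... | false | false = refl

sparsity-ignoresFirst : (F : IntFun n) → sparsity (F ∘ tail) ≡ sparsity F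
sparsity-ignoresFirst F = begin
  sparsity (F ⊕ F) + sparsity (F ⊖ F)  ≡⟨ cong₂ _+_ (sparsity-⊕-self F) (sparsity-⊖-self F) ⟩
  sparsity F + 0                       ≡⟨ +-identityʳ (sparsity F) ⟩
  sparsity F                           ∎
  where open ≡-Reasoning

-- Stated for a pair (G, H) so that the induction can pass a fixed coordinate where A and B
-- differ, by moving to the cofactors of G and H selected by A and by B.
sparsity-override-pair : (G H : IntFun n) (D A B : Vec Bool n) {c : ℤ} → G ∘ override D A ≗ const c →
  2 * sparsity (H ∘ override D B) ≤ sparsity (G ⊕ H) + sparsity (G ⊖ H) + nonZero c
sparsity-override-pair {zero} G H [] [] [] G≗c =
  subst (λ c → _ ≤ _ + nonZero c) (G≗c []) (nonZero-pair (G []) (H []))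
sparsity-override-pair {suc n} G H (true ∷ D) (a ∷ A) (b ∷ B) {c} G≗c = begin
  2 * sparsity (H ∘ override (true ∷ D) (b ∷ B))
    ≡⟨ cong (2 *_) (sparsity-ignoresFirst (cofactor b H ∘ override D B)) ⟩
  2 * sparsity (cofactor b H ∘ override D B)
    ≤⟨ sparsity-override-pair (cofactor a G) (cofactor b H) D A B (G≗c ∘ (false ∷_)) ⟩
  sparsity (cofactor a G ⊕ cofactor b H) + sparsity (cofactor a G ⊖ cofactor b H) + nonZero c
    ≤⟨ +-monoˡ-≤ (nonZero c) (sparsity-cofactor-pair a b G H) ⟩
  sparsity (G ⊕ H) + sparsity (G ⊖ H) + nonZero c ∎
  where open ≤-Reasoning
sparsity-override-pair {suc n} G H (false ∷ D) (a ∷ A) (b ∷ B) {c} G≗c = begin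
  2 * (sparsity (evenPart H ∘ override D B) + sparsity (oddPart H ∘ override D B))
    ≡⟨ *-distribˡ-+ 2 (sparsity (evenPart H ∘ override D B)) _ ⟩
  2 * sparsity (evenPart H ∘ override D B) + 2 * sparsity (oddPart H ∘ override D B)
    ≤⟨ +-mono-≤ even odd ⟩
  (sparsity (evenPart G ⊕ evenPart H) + sparsity (evenPart G ⊖ evenPart H) + nonZero c) +
  (sparsity (oddPart G ⊕ oddPart H) + sparsity (oddPart G ⊖ oddPart H) + 0)
    ≡⟨ regroup (sparsity (evenPart G ⊕ evenPart H)) _ _ _ _ ⟩
  (sparsity (evenPart G ⊕ evenPart H) + sparsity (oddPart G ⊕ oddPart H)) +
  (sparsity (evenPart G ⊖ evenPart H) + sparsity (oddPart G ⊖ oddPart H)) + nonZero c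
    ≡⟨ cong (_+ nonZero c) (cong₂ _+_ (sparsity-⊕-split G H) (sparsity-⊖-split G H)) ⟨
  sparsity (G ⊕ H) + sparsity (G ⊖ H) + nonZero c ∎
  where
  open ≤-Reasoning
  even : 2 * sparsity (evenPart H ∘ override D B) ≤
         sparsity (evenPart G ⊕ evenPart H) + sparsity (evenPart G ⊖ evenPart H) + nonZero c
  even = subst (λ k → _ ≤ _ + k) (nonZero-double c)
    (sparsity-override-pair (evenPart G) (evenPart H) D A B
      (λ x → cong₂ ℤ._+_ (G≗c (false ∷ x)) (G≗c (true ∷ x))))
  odd : 2 * sparsity (oddPart H ∘ override D B) ≤
        sparsity (oddPart G ⊕ oddPart H) + sparsity (oddPart G ⊖ oddPart H) + 0
  odd = subst (λ k → _ ≤ _ + nonZero k) (ℤ.+-inverseʳ c)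
    (sparsity-override-pair (oddPart G) (oddPart H) D A B
      (λ x → cong₂ ℤ._-_ (G≗c (false ∷ x)) (G≗c (true ∷ x))))
  regroup : ∀ a b c d k → (a + b + k) + (c + d + 0) ≡ (a + c) + (b + d) + k
  regroup = ℕ-Solver.solve-∀

sparsity-override-halves : (F : IntFun n) (D A B : Vec Bool n) {c : ℤ} → F ∘ override D A ≗ const c →
  2 * sparsity (F ∘ override D B) ≤ sparsity F + nonZero c
sparsity-override-halves F D A B {c} F≗c = begin
  2 * sparsity (F ∘ override D B)
    ≤⟨ sparsity-override-pair F F D A B F≗c ⟩
  sparsity (F ⊕ F) + sparsity (F ⊖ F) + nonZero c
    ≡⟨ cong (_+ nonZero c) (cong₂ _+_ (sparsity-⊕-self F) (sparsity-⊖-self F)) ⟩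
  sparsity F + 0 + nonZero c
    ≡⟨ cong (_+ nonZero c) (+-identityʳ (sparsity F)) ⟩
  sparsity F + nonZero c ∎
  where open ≤-Reasoning

-- Sparsity counts the nonzero Walsh coefficients

∑ : List ℤ → ℤ
∑ = List.foldr ℤ._+_ 0ℤ

∑-++ : ∀ xs ys → ∑ (xs ++ ys) ≡ ∑ xs ℤ.+ ∑ ys
∑-++ []       ys = sym (ℤ.+-identityˡ (∑ ys))
∑-++ (x ∷ xs) ys = trans (cong (ℤ._+_ x) (∑-++ xs ys)) (sym (ℤ.+-assoc x (∑ xs) (∑ ys)))

∑-map-+ : ∀ {A : Set} (g h : A → ℤ) xs → ∑ (map (λ x → g x ℤ.+ h x) xs) ≡ ∑ (map g xs) ℤ.+ ∑ (map h xs)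
∑-map-+ g h []       = refl
∑-map-+ g h (x ∷ xs) = trans (cong (ℤ._+_ (g x ℤ.+ h x)) (∑-map-+ g h xs)) (regroup (g x) (h x) _ _)
  where regroup : ∀ a b c d → a ℤ.+ b ℤ.+ (c ℤ.+ d) ≡ a ℤ.+ c ℤ.+ (b ℤ.+ d)
        regroup = solve-∀

∑-map-neg : ∀ {A : Set} (g : A → ℤ) xs → ∑ (map (λ x → ℤ.- g x) xs) ≡ ℤ.- ∑ (map g xs)
∑-map-neg g []       = refl
∑-map-neg g (x ∷ xs) = trans (cong (ℤ._+_ (ℤ.- g x)) (∑-map-neg g xs)) (sym (ℤ.neg-distrib-+ (g x) _))

module _ {A : Set} (Σ : List A → A) (_∙_ : A → A → A) (Σ-++ : ∀ xs ys → Σ (xs ++ ys) ≡ Σ xs ∙ Σ ys) where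

  Σ-allInputs : (φ : Vec Bool (suc n) → A) →
    Σ (map φ (allInputs (suc n))) ≡
    Σ (map (φ ∘ (false ∷_)) (allInputs n)) ∙ Σ (map (φ ∘ (true ∷_)) (allInputs n))
  Σ-allInputs {n} φ = begin
    Σ (map φ (map (false ∷_) xs ++ map (true ∷_) xs))         ≡⟨ cong Σ (List.map-++ φ (map (false ∷_) xs) _) ⟩
    Σ (map φ (map (false ∷_) xs) ++ map φ (map (true ∷_) xs)) ≡⟨ Σ-++ (map φ (map (false ∷_) xs)) _ ⟩
    Σ (map φ (map (false ∷_) xs)) ∙ Σ (map φ (map (true ∷_) xs))
                                         ≡⟨ cong₂ _∙_ (cong Σ (List.map-∘ xs)) (cong Σ (List.map-∘ xs)) ⟨
    Σ (map (φ ∘ (false ∷_)) xs) ∙ Σ (map (φ ∘ (true ∷_)) xs)  ∎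
    where open ≡-Reasoning
          xs = allInputs n

walsh : IntFun n → Vec Bool n → ℤ
walsh {n} F S = ∑ (map (λ x → F x ℤ.* χ S x) (allInputs n))

walsh-⊕ : (F G : IntFun n) (S : Vec Bool n) → walsh (F ⊕ G) S ≡ walsh F S ℤ.+ walsh G S
walsh-⊕ {n} F G S = trans (cong ∑ (List.map-cong (λ x → ℤ.*-distribʳ-+ (χ S x) (F x) (G x)) (allInputs n)))
                          (∑-map-+ (λ x → F x ℤ.* χ S x) (λ x → G x ℤ.* χ S x) (allInputs n))

walsh-⊖ : (F G : IntFun n) (S : Vec Bool n) → walsh (F ⊖ G) S ≡ walsh F S ℤ.- walsh G S
walsh-⊖ {n} F G S = trans (walsh-⊕ F (ℤ.-_ ∘ G) S) (cong (ℤ._+_ (walsh F S)) walsh-neg)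
  where walsh-neg : walsh (ℤ.-_ ∘ G) S ≡ ℤ.- walsh G S
        walsh-neg = trans (cong ∑ (List.map-cong (λ x → sym (ℤ.neg-distribˡ-* (G x) (χ S x))) (allInputs n)))
                          (∑-map-neg (λ x → G x ℤ.* χ S x) (allInputs n))

χ-flip : (S x : Vec Bool n) → χ (true ∷ S) (true ∷ x) ≡ ℤ.- χ S x
χ-flip S x with xorAll (zipWith _∧_ S x)
... | true  = refl
... | false = refl

walsh-false : (F : IntFun (suc n)) (S : Vec Bool n) → walsh F (false ∷ S) ≡ walsh (evenPart F) S
walsh-false F S = trans (Σ-allInputs ∑ ℤ._+_ ∑-++ (λ x → F x ℤ.* χ (false ∷ S) x))
                        (sym (walsh-⊕ (cofactor false F) (cofactor true F) S))

walsh-true : (F : IntFun (suc n)) (S : Vec Bool n) → walsh F (true ∷ S) ≡ walsh (oddPart F) S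
walsh-true {n} F S = begin
  walsh F (true ∷ S)
    ≡⟨ Σ-allInputs ∑ ℤ._+_ ∑-++ (λ x → F x ℤ.* χ (true ∷ S) x) ⟩
  walsh (cofactor false F) S ℤ.+ ∑ (map (λ x → F (true ∷ x) ℤ.* χ (true ∷ S) (true ∷ x)) (allInputs n))
    ≡⟨ cong (ℤ._+_ (walsh (cofactor false F) S)) (trans (cong ∑ (List.map-cong flip (allInputs n)))
                                                      (∑-map-neg (λ x → F (true ∷ x) ℤ.* χ S x) (allInputs n))) ⟩
  walsh (cofactor false F) S ℤ.- walsh (cofactor true F) S
    ≡⟨ walsh-⊖ (cofactor false F) (cofactor true F) S ⟨
  walsh (oddPart F) S ∎
  where
  open ≡-Reasoning
  flip : ∀ x → F (true ∷ x) ℤ.* χ (true ∷ S) (true ∷ x) ≡ ℤ.- (F (true ∷ x) ℤ.* χ S x)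
  flip x = trans (cong (F (true ∷ x) ℤ.*_) (χ-flip S x)) (sym (ℤ.neg-distribʳ-* (F (true ∷ x)) (χ S x)))

sum-nonZero-walsh : (F : IntFun n) → sum (map (nonZero ∘ walsh F) (allInputs n)) ≡ sparsity F
sum-nonZero-walsh {zero} F =
  trans (+-identityʳ _) (cong nonZero (trans (ℤ.+-identityʳ _) (ℤ.*-identityʳ (F []))))
sum-nonZero-walsh {suc n} F = begin
  sum (map (nonZero ∘ walsh F) (allInputs (suc n)))
    ≡⟨ Σ-allInputs sum _+_ sum-++ (nonZero ∘ walsh F) ⟩
  sum (map (nonZero ∘ walsh F ∘ (false ∷_)) xs) + sum (map (nonZero ∘ walsh F ∘ (true ∷_)) xs)
    ≡⟨ cong₂ _+_ (cong sum (List.map-cong (cong nonZero ∘ walsh-false F) xs))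
                 (cong sum (List.map-cong (cong nonZero ∘ walsh-true F) xs)) ⟩
  sum (map (nonZero ∘ walsh (evenPart F)) xs) + sum (map (nonZero ∘ walsh (oddPart F)) xs)
    ≡⟨ cong₂ _+_ (sum-nonZero-walsh (evenPart F)) (sum-nonZero-walsh (oddPart F)) ⟩
  sparsity F ∎
  where open ≡-Reasoning
        xs = allInputs n

length-filter-nonZero : ∀ {A : Set} (h : A → ℤ) xs →
  length (filter (λ S → ¬? (h S ℤ.≟ 0ℤ)) xs) ≡ sum (map (nonZero ∘ h) xs)
length-filter-nonZero h [] = refl
length-filter-nonZero h (x ∷ xs) with h x ℤ.≟ 0ℤ
... | yes hx≡0 =
  trans (length-filter-nonZero h xs) (cong (λ z → nonZero z + sum (map (nonZero ∘ h) xs)) (sym hx≡0))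
... | no  hx≢0 = cong₂ _+_ (sym (≢0⇒nonZero≡1 hx≢0)) (length-filter-nonZero h xs)

spar≡sparsity : (f : BoolFun n) → spar f ≡ sparsity (toℤ ∘ f)
spar≡sparsity {n} f = begin
  spar f
    ≡⟨ length-filter-nonZero (scaledFourier f) (allInputs n) ⟩
  sum (map (nonZero ∘ scaledFourier f) (allInputs n))
    ≡⟨ cong sum (List.map-cong (cong nonZero ∘ scaledFourier≡walsh) (allInputs n)) ⟩
  sum (map (nonZero ∘ walsh (toℤ ∘ f)) (allInputs n))
    ≡⟨ sum-nonZero-walsh (toℤ ∘ f) ⟩
  sparsity (toℤ ∘ f) ∎
  where
  open ≡-Reasoning
  scaledFourier≡walsh : ∀ S → scaledFourier f S ≡ walsh (toℤ ∘ f) S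
  scaledFourier≡walsh S = cong ∑ (List.map-cong indicator (allInputs n))
    where indicator : ∀ x → (if f x then χ S x else 0ℤ) ≡ toℤ (f x) ℤ.* χ S x
          indicator x with f x
          ... | true  = sym (ℤ.*-identityˡ (χ S x))
          ... | false = sym (ℤ.*-zeroˡ (χ S x))

-- Decision trees

rankCombine-≥ˡ : ∀ a b → a ≤ rankCombine a b
rankCombine-≥ˡ a b with a ≟ b
... | yes _ = n≤1+n a
... | no  _ = m≤m⊔n a b

rankCombine-≥ʳ : ∀ a b → b ≤ rankCombine a b
rankCombine-≥ʳ a b with a ≟ b
... | yes refl = n≤1+n a
... | no  _    = m≤n⊔m a b

rankCombine-> : ∀ {m} a b → m ≤ a → m ≤ b → suc m ≤ rankCombine a b
rankCombine-> a b m≤a m≤b with a ≟ b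
... | yes refl = s≤s m≤a
... | no  a≢b  = [ (λ a≤b → ≤-trans (s≤s m≤a) (≤-trans (≤∧≢⇒< a≤b a≢b) (m≤n⊔m a b)))
                 , (λ b≤a → ≤-trans (s≤s m≤b) (≤-trans (≤∧≢⇒< b≤a (a≢b ∘ sym)) (m≤m⊔n a b))) ]′ (≤-total a b)

rankCombine≤ : ∀ a b → rankCombine a b ≤ suc (a ⊔ b)
rankCombine≤ a b with a ≟ b
... | yes refl = s≤s (m≤m⊔n a a)
... | no  _    = n≤1+n (a ⊔ b)

rankCombine-idem : ∀ a → rankCombine a a ≡ suc a
rankCombine-idem a with a ≟ a
... | yes _   = refl
... | no  a≢a = contradiction refl a≢a

rank≤depth : (t : DTree n) → rank t ≤ depth t
rank≤depth (leaf _)     = z≤n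
rank≤depth (node _ l r) =
  ≤-trans (rankCombine≤ (rank l) (rank r)) (s≤s (⊔-mono-≤ (rank≤depth l) (rank≤depth r)))

eval-node : ∀ {β} (i : Fin n) (l r : DTree n) {x} → lookup x i ≡ β →
  eval (node i l r) x ≡ eval (if β then r else l) x
eval-node i l r {x} refl with lookup x i
... | true  = refl
... | false = refl

freeCount : Vec Bool n → ℕ
freeCount []          = 0
freeCount (true ∷ D)  = freeCount D
freeCount (false ∷ D) = suc (freeCount D)

freeCount-none : ∀ n → freeCount (replicate n false) ≡ n
freeCount-none zero    = refl
freeCount-none (suc n) = cong suc (freeCount-none n)

freeCount-fix : (D : Vec Bool n) (i : Fin n) → lookup D i ≡ false →
  freeCount D ≡ suc (freeCount (D [ i ]≔ true))
freeCount-fix (false ∷ D) Fin.zero    _  = refl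
freeCount-fix (true  ∷ D) (Fin.suc i) Dᵢ = freeCount-fix D i Dᵢ
freeCount-fix (false ∷ D) (Fin.suc i) Dᵢ = cong suc (freeCount-fix D i Dᵢ)

-- Where a low-rank path of t, started from the restriction (D, A), leads: the variables it
-- newly fixes and the leaf it reaches.
record PathExtension (t : DTree n) (D A : Vec Bool n) : Set where
  field
    D′ A′     : Vec Bool n
    queried   : List (Fin n)
    leafValue : Bool
    D⊆D′      : ∀ i → lookup D i ≡ true → lookup D′ i ≡ true
    A′≈A      : ∀ i → lookup D i ≡ true → lookup A′ i ≡ lookup A i
    constant  : ∀ x → eval t (override D′ A′ x) ≡ leafValue
    queried≤rank : length queried ≤ rank t
    D′∖D⊆queried : ∀ i → lookup D′ i ≡ true → lookup D i ≡ false → i ∈ queried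
    freeCount-≤  : freeCount D ≤ length queried + freeCount D′

module _ {n} (i : Fin n) (l r : DTree n) {D A : Vec Bool n} where

  private
    branch : Bool → DTree n
    branch β = if β then r else l

  descendFixed : lookup D i ≡ true → ∀ {β} → lookup A i ≡ β → rank (branch β) ≤ rank (node i l r) →
    PathExtension (branch β) D A → PathExtension (node i l r) D A
  descendFixed Dᵢ Aᵢ rank≤ ext = record
    { PathExtension ext
    ; constant     = λ x → trans (eval-node i l r (trans (override-fixed D′ A′ x (D⊆D′ i Dᵢ))
                                                         (trans (A′≈A i Dᵢ) Aᵢ)))
                                 (constant x)
    ; queried≤rank = ≤-trans queried≤rank rank≤
    }
    where open PathExtension ext

  descendFree : lookup D i ≡ false → ∀ β → suc (rank (branch β)) ≤ rank (node i l r) →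
    PathExtension (branch β) (D [ i ]≔ true) (A [ i ]≔ β) → PathExtension (node i l r) D A
  descendFree Dᵢ β rank< ext = record
    { D′ = D′ ; A′ = A′ ; queried = i ∷ queried ; leafValue = leafValue
    ; D⊆D′         = λ j Dⱼ → D⊆D′ j (trans (Vecₚ.lookup∘update′ (≢i j Dⱼ) D true) Dⱼ)
    ; A′≈A         = λ j Dⱼ → trans (A′≈A j (trans (Vecₚ.lookup∘update′ (≢i j Dⱼ) D true) Dⱼ))
                                    (Vecₚ.lookup∘update′ (≢i j Dⱼ) A β)
    ; constant     = λ x → trans (eval-node i l r (trans (override-fixed D′ A′ x fixedᵢ) valueᵢ)) (constant x)
    ; queried≤rank = ≤-trans (s≤s queried≤rank) rank<
    ; D′∖D⊆queried = covers
    ; freeCount-≤  = ≤-trans (≤-reflexive (freeCount-fix D i Dᵢ)) (s≤s freeCount-≤)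
    }
    where
    open PathExtension ext
    ≢i : ∀ j → lookup D j ≡ true → j ≢ i
    ≢i j Dⱼ refl = contradiction (trans (sym Dᵢ) Dⱼ) λ ()
    fixedᵢ : lookup D′ i ≡ true
    fixedᵢ = D⊆D′ i (Vecₚ.lookup∘update i D true)
    valueᵢ : lookup A′ i ≡ β
    valueᵢ = trans (A′≈A i (Vecₚ.lookup∘update i D true)) (Vecₚ.lookup∘update i A β)
    covers : ∀ j → lookup D′ j ≡ true → lookup D j ≡ false → j ∈ i ∷ queried
    covers j D′ⱼ Dⱼ with i Finₚ.≟ j
    ... | yes refl = here refl
    ... | no  i≢j  = there (D′∖D⊆queried j D′ⱼ (trans (Vecₚ.lookup∘update′ (i≢j ∘ sym) D true) Dⱼ))

followLowRank : (t : DTree n) (D A : Vec Bool n) → PathExtension t D A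
followLowRank (leaf b) D A = record
  { D′ = D ; A′ = A ; queried = [] ; leafValue = b
  ; D⊆D′ = λ _ Dᵢ → Dᵢ ; A′≈A = λ _ _ → refl ; constant = λ _ → refl ; queried≤rank = z≤n
  ; D′∖D⊆queried = λ _ D′ᵢ Dᵢ → contradiction (trans (sym D′ᵢ) Dᵢ) λ ()
  ; freeCount-≤ = ≤-refl }
followLowRank (node i l r) D A with lookup D i in Dᵢ
... | true with lookup A i in Aᵢ
...   | false = descendFixed i l r Dᵢ Aᵢ (rankCombine-≥ˡ (rank l) (rank r)) (followLowRank l D A)
...   | true  = descendFixed i l r Dᵢ Aᵢ (rankCombine-≥ʳ (rank l) (rank r)) (followLowRank r D A)
followLowRank (node i l r) D A | false with rank l ≤? rank r
...   | yes l≤r = descendFree i l r Dᵢ false (rankCombine-> (rank l) (rank r) ≤-refl l≤r)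
                    (followLowRank l (D [ i ]≔ true) (A [ i ]≔ false))
...   | no  l≰r = descendFree i l r Dᵢ true (rankCombine-> (rank l) (rank r) (<⇒≤ (≰⇒> l≰r)) ≤-refl)
                    (followLowRank r (D [ i ]≔ true) (A [ i ]≔ true))

queryAll : List (Fin n) → (Vec Bool n → DTree n) → DTree n
queryAll {n} []       k = k (replicate n false)
queryAll     (i ∷ is) k =
  node i (queryAll is (λ y → k (y [ i ]≔ false))) (queryAll is (λ y → k (y [ i ]≔ true)))

eval-queryAll : (is : List (Fin n)) (k : Vec Bool n → DTree n) (x : Vec Bool n) →
  ∃ λ y → (∀ {j} → j ∈ is → lookup y j ≡ lookup x j) × eval (queryAll is k) x ≡ eval (k y) x
eval-queryAll []       k x = replicate _ false , (λ ()) , refl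
eval-queryAll (i ∷ is) k x =
  let y , y≈x , eval≡ = eval-queryAll is (λ y → k (y [ i ]≔ lookup x i)) x
  in y [ i ]≔ lookup x i , agree {y} y≈x , trans (answer refl) eval≡
  where
  after : Bool → DTree _
  after β = queryAll is (λ y → k (y [ i ]≔ β))
  answer : ∀ {β} → lookup x i ≡ β → eval (queryAll (i ∷ is) k) x ≡ eval (after β) x
  answer {false} = eval-node i (after false) (after true)
  answer {true}  = eval-node i (after false) (after true)
  agree : ∀ {y} → (∀ {j} → j ∈ is → lookup y j ≡ lookup x j) →
          ∀ {j} → j ∈ i ∷ is → lookup (y [ i ]≔ lookup x i) j ≡ lookup x j
  agree {y} y≈x {j} j∈ with j Finₚ.≟ i
  ... | yes refl = Vecₚ.lookup∘update i y (lookup x i)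
  ... | no  j≢i  = trans (Vecₚ.lookup∘update′ j≢i y (lookup x i)) (y≈x (Any.tail j≢i j∈))

depth-queryAll : (is : List (Fin n)) (k : Vec Bool n → DTree n) {M : ℕ} →
  (∀ y → depth (k y) ≤ M) → depth (queryAll is k) ≤ length is + M
depth-queryAll []       k depth≤ = depth≤ _
depth-queryAll (i ∷ is) k depth≤ =
  s≤s (⊔-lub (depth-queryAll is _ (depth≤ ∘ (_[ i ]≔ false))) (depth-queryAll is _ (depth≤ ∘ (_[ i ]≔ true))))

2*≤2*+1⇒≤ : ∀ {m n} → 2 * m ≤ 2 * n + 1 → m ≤ n
2*≤2*+1⇒≤ {m} {n} le = m<1+n⇒m≤n (*-cancelˡ-< 2 m (suc n) (begin-strict
  2 * m         ≤⟨ le ⟩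
  2 * n + 1     <⟨ +-monoʳ-< (2 * n) ≤-refl ⟩
  2 * n + 2     ≡⟨ +-comm (2 * n) 2 ⟩
  2 + 2 * n     ≡⟨ *-suc 2 n ⟨
  2 * suc n     ∎))
  where open ≤-Reasoning

module _ {t : DTree n} {D A : Vec Bool n} (path : PathExtension t D A) where

  open PathExtension path

  queryAll-computes : (f : BoolFun n) (k : Vec Bool n → DTree n) →
    (∀ y → Computes (k y) (f ∘ override D′ (override D A y))) →
    Computes (queryAll queried k) (f ∘ override D A)
  queryAll-computes f k k-computes x =
    let y , y≈x , eval≡ = eval-queryAll queried k x
    in trans eval≡ (trans (k-computes y x)
                          (cong f (override-refine D⊆D′ y x λ i D′ᵢ Dᵢ → y≈x (D′∖D⊆queried i D′ᵢ Dᵢ))))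

  sparsity-after-path : (f : BoolFun n) → Computes t f → ∀ y →
    2 * sparsity (toℤ ∘ f ∘ override D′ (override D A y)) ≤ sparsity (toℤ ∘ f ∘ override D A) + 1
  sparsity-after-path f t-computes y = begin
    2 * sparsity (toℤ ∘ f ∘ override D′ B)
      ≡⟨ cong (2 *_) (sparsity-cong (cong (toℤ ∘ f) ∘ override-absorb D⊆D′ B≈A)) ⟨
    2 * sparsity (F ∘ override D′ B)
      ≤⟨ sparsity-override-halves F D′ A′ B F-constant ⟩
    sparsity F + nonZero (toℤ leafValue)
      ≤⟨ +-monoʳ-≤ (sparsity F) (nonZero≤1 (toℤ leafValue)) ⟩
    sparsity F + 1 ∎
    where
    open ≤-Reasoning
    F : IntFun _
    F = toℤ ∘ f ∘ override D A
    B = override D A y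
    B≈A : ∀ i → lookup D i ≡ true → lookup B i ≡ lookup A i
    B≈A i = override-fixed D A y
    F-constant : F ∘ override D′ A′ ≗ const (toℤ leafValue)
    F-constant x = cong toℤ (trans (cong f (override-absorb D⊆D′ A′≈A x))
                                   (trans (sym (t-computes (override D′ A′ x))) (constant x)))

module _ {n} (f : BoolFun n) (t : DTree n) (t-computes : Computes t f) where

  -- Each round queries the at most rank t variables of a low-rank path and halves the sparsity.
  shallowTree : ∀ L (D A : Vec Bool n) → sparsity (toℤ ∘ f ∘ override D A) ≤ 2 ^ L →
    ∃ λ T → Computes T (f ∘ override D A) × depth T ≤ L * rank t
  shallowTree zero D A sp≤1 =
    leaf (f (override D A z)) , sparsity≤1⇒constant (f ∘ override D A) sp≤1 z , z≤n
    where z = replicate n false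
  shallowTree (suc L) D A sp≤2^L+1 =
    queryAll queried subtree , queryAll-computes path f subtree (proj₁ ∘ proj₂ ∘ recurse) , depth≤
    where
    path = followLowRank t D A
    open PathExtension path
    recurse : ∀ y → ∃ λ T → Computes T (f ∘ override D′ (override D A y)) × depth T ≤ L * rank t
    recurse y = shallowTree L D′ (override D A y)
      (2*≤2*+1⇒≤ (≤-trans (sparsity-after-path path f t-computes y) (+-monoˡ-≤ 1 sp≤2^L+1)))
    subtree : Vec Bool n → DTree n
    subtree = proj₁ ∘ recurse
    depth≤ : depth (queryAll queried subtree) ≤ suc L * rank t
    depth≤ = ≤-trans (depth-queryAll queried subtree (proj₂ ∘ proj₂ ∘ recurse))
                     (+-monoˡ-≤ (L * rank t) queried≤rank)

depth≤log·rank : (f : BoolFun n) {d r : ℕ} → IsDepth f d → IsRank f r → ∀ L → spar f ≤ 2 ^ L → d ≤ L * r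
depth≤log·rank {n} f (_ , depth-min) ((t , t-computes , t-rank) , _) L spar≤2^L =
  let T , T-computes , T-depth = shallowTree f t t-computes L none none sparsity≤2^L
  in ≤-trans (depth-min T λ x → trans (T-computes x) (cong f (override-none none x)))
             (subst (λ r → depth T ≤ L * r) t-rank T-depth)
  where
  none = replicate n false
  sparsity≤2^L : sparsity (toℤ ∘ f ∘ override none none) ≤ 2 ^ L
  sparsity≤2^L = ≤-trans (≤-reflexive (trans (sparsity-cong (cong (toℤ ∘ f) ∘ override-none none))
                                             (sym (spar≡sparsity f)))) spar≤2^L

n≤2^n : ∀ n → n ≤ 2 ^ n
n≤2^n zero    = z≤n
n≤2^n (suc n) = +-mono-≤ (m^n>0 2 n) (≤-trans (n≤2^n n) (m≤m+n (2 ^ n) 0))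

power-of-2-between : ∀ {s} k → 1 ≤ s → s ≤ 2 ^ k → ∃ λ L → s ≤ 2 ^ L × 2 ^ L ≤ 2 * s
power-of-2-between {s} zero    1≤s s≤1 = 0 , s≤1 , ≤-trans 1≤s (m≤m+n s (1 * s))
power-of-2-between {s} (suc k) 1≤s s≤2^k+1 with s ≤? 2 ^ k
... | yes s≤2^k = power-of-2-between k 1≤s s≤2^k
... | no  s≰2^k = suc k , s≤2^k+1 , *-monoʳ-≤ 2 (<⇒≤ (≰⇒> s≰2^k))

^-distribʳ-* : ∀ m n o → (m * n) ^ o ≡ m ^ o * n ^ o
^-distribʳ-* m n zero    = refl
^-distribʳ-* m n (suc o) = trans (cong (m * n *_) (^-distribʳ-* m n o)) (regroup m n (m ^ o) (n ^ o))
  where regroup : ∀ a b c d → a * b * (c * d) ≡ a * c * (b * d)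
        regroup = ℕ-Solver.solve-∀

depth-rank-sparsity : (f : BoolFun n) {d r : ℕ} → IsDepth f d → IsRank f r → 2 ^ d ≤ 2 ^ r * spar f ^ r
depth-rank-sparsity f {d} {r} isDepth@((T , T-computes , T-depth) , _) isRank@(_ , rank-min)
  with spar f in spar≡
... | zero = subst₂ (λ d r → 2 ^ d ≤ 2 ^ r * 0 ^ r) (sym d≡0) (sym r≡0) ≤-refl
  where
  d≡0 : d ≡ 0
  d≡0 = n≤0⇒n≡0 (depth≤log·rank f isDepth isRank 0 (≤-trans (≤-reflexive spar≡) z≤n))
  r≡0 : r ≡ 0
  r≡0 = n≤0⇒n≡0 (≤-trans (rank-min T T-computes) (≤-trans (rank≤depth T) (≤-reflexive (trans T-depth d≡0))))
... | suc s =
  let L , s≤2^L , 2^L≤2s = power-of-2-between (suc s) (s≤s z≤n) (n≤2^n (suc s))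
  in begin
    2 ^ d                  ≤⟨ ^-monoʳ-≤ 2 (depth≤log·rank f isDepth isRank L
                                                   (≤-trans (≤-reflexive spar≡) s≤2^L)) ⟩
    2 ^ (L * r)            ≡⟨ ^-*-assoc 2 L r ⟨
    (2 ^ L) ^ r            ≤⟨ ^-monoˡ-≤ r 2^L≤2s ⟩
    (2 * suc s) ^ r        ≡⟨ ^-distribʳ-* 2 (suc s) r ⟩
    2 ^ r * suc s ^ r      ∎
  where open ≤-Reasoning

-- Parity

sparsity-χ : (S : Vec Bool n) → sparsity (χ S) ≡ 1
sparsity-χ {zero}  []        = refl
sparsity-χ {suc n} (false ∷ S) = trans (sparsity-ignoresFirst (χ S)) (sparsity-χ S)
sparsity-χ {suc n} (true ∷ S)  = begin
  sparsity (evenPart (χ (true ∷ S))) + sparsity (oddPart (χ (true ∷ S)))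
    ≡⟨ cong₂ _+_ (sparsity-cong cancel) (sparsity-cong double) ⟩
  sparsity {n = n} (const 0ℤ) + sparsity (χ S ⊕ χ S)
    ≡⟨ cong₂ _+_ (sparsity-const {n = n} 0ℤ) (sparsity-⊕-self (χ S)) ⟩
  sparsity (χ S)
    ≡⟨ sparsity-χ S ⟩
  1 ∎
  where
  open ≡-Reasoning
  cancel : evenPart (χ (true ∷ S)) ≗ const 0ℤ
  cancel x = trans (cong (ℤ._+_ (χ S x)) (χ-flip S x)) (ℤ.+-inverseʳ (χ S x))
  double : oddPart (χ (true ∷ S)) ≗ χ S ⊕ χ S
  double x = cong (ℤ._+_ (χ S x)) (trans (cong ℤ.-_ (χ-flip S x)) (ℤ.neg-involutive (χ S x)))

spar-parity : ∀ n → spar (PARITY (suc n)) ≡ 2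
spar-parity n = begin
  spar (PARITY (suc n))
    ≡⟨ spar≡sparsity (PARITY (suc n)) ⟩
  sparsity (evenPart (toℤ ∘ PARITY (suc n))) + sparsity (oddPart (toℤ ∘ PARITY (suc n)))
    ≡⟨ cong₂ _+_ (sparsity-cong even) (sparsity-cong odd) ⟩
  sparsity {n = n} (const 1ℤ) + sparsity (-1ℤ · χ (replicate n true))
    ≡⟨ cong₂ _+_ (sparsity-const {n = n} 1ℤ)
                 (trans (sparsity-· {k = -1ℤ} (λ ()) (χ (replicate n true))) (sparsity-χ (replicate n true))) ⟩
  2 ∎
  where
  open ≡-Reasoning
  χ-ones : ∀ x → χ (replicate n true) x ≡ (if xorAll x then -1ℤ else 1ℤ)
  χ-ones x = cong (λ b → if xorAll b then -1ℤ else 1ℤ)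
                  (trans (Vecₚ.zipWith-replicate₁ _∧_ true x) (Vecₚ.map-id x))
  even : evenPart (toℤ ∘ PARITY (suc n)) ≗ const 1ℤ
  even x with xorAll x
  ... | true  = refl
  ... | false = refl
  odd : oddPart (toℤ ∘ PARITY (suc n)) ≗ -1ℤ · χ (replicate n true)
  odd x rewrite χ-ones x with xorAll x
  ... | true  = refl
  ... | false = refl

parityTree : ∀ {k} → Vec (Fin n) k → Bool → DTree n
parityTree []       b = leaf b
parityTree (i ∷ is) b = node i (parityTree is b) (parityTree is (not b))

eval-parityTree : ∀ {k} (is : Vec (Fin n) k) b x →
  eval (parityTree is b) x ≡ b xor xorAll (Vec.map (lookup x) is)
eval-parityTree []       b x = sym (xor-identityʳ b)
eval-parityTree (i ∷ is) b x with lookup x i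
... | false = eval-parityTree is b x
... | true  = trans (eval-parityTree is (not b) x)
                    (trans (sym (not-distribˡ-xor b _)) (not-distribʳ-xor b _))

rank-parityTree : ∀ {k} (is : Vec (Fin n) k) b → rank (parityTree is b) ≡ k
rank-parityTree []       b = refl
rank-parityTree (i ∷ is) b rewrite rank-parityTree is b | rank-parityTree is (not b) = rankCombine-idem _

depth-parityTree : ∀ {k} (is : Vec (Fin n) k) b → depth (parityTree is b) ≡ k
depth-parityTree []       b = refl
depth-parityTree (i ∷ is) b rewrite depth-parityTree is b | depth-parityTree is (not b) = cong suc (⊔-idem _)

parityTree-computes : ∀ n → Computes (parityTree (allFin n) false) (PARITY n)
parityTree-computes n x = trans (eval-parityTree (allFin n) false x) (cong xorAll (Vecₚ.map-lookup-allFin x))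

parity-override-constant : (D A : Vec Bool n) {c : Bool} → (∀ x → xorAll (override D A x) ≡ c) → freeCount D ≡ 0
parity-override-constant []          []      _         = refl
parity-override-constant (true ∷ D)  (a ∷ A) {c} const = parity-override-constant D A {a xor c} λ x → begin
  xorAll (override D A x)                   ≡⟨ cong (_xor xorAll (override D A x)) (xor-same a) ⟨
  (a xor a) xor xorAll (override D A x)     ≡⟨ xor-assoc a a _ ⟩
  a xor (a xor xorAll (override D A x))     ≡⟨ cong (a xor_) (const (false ∷ x)) ⟩
  a xor c                                   ∎
  where open ≡-Reasoning
parity-override-constant {suc n} (false ∷ D) (a ∷ A) const =
  contradiction (trans (const (false ∷ z)) (sym (const (true ∷ z)))) (not-¬ refl)
  where z = replicate n false

-- A low-rank path of a parity tree fixes every variable.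
rank-parity : (t : DTree n) → Computes t (PARITY n) → n ≤ rank t
rank-parity {n} t t-computes = begin
  n                             ≡⟨ freeCount-none n ⟨
  freeCount none                ≤⟨ freeCount-≤ ⟩
  length queried + freeCount D′ ≡⟨ cong (length queried +_) D′-full ⟩
  length queried + 0            ≡⟨ +-identityʳ _ ⟩
  length queried                ≤⟨ queried≤rank ⟩
  rank t                        ∎
  where
  open ≤-Reasoning
  none = replicate n false
  open PathExtension (followLowRank t none none)
  D′-full : freeCount D′ ≡ 0
  D′-full = parity-override-constant D′ A′ λ x → trans (sym (t-computes (override D′ A′ x))) (constant x)

parity-depth-rank-sparsity : ∀ n →
  IsDepth (PARITY (suc n)) (suc n) × IsRank (PARITY (suc n)) (suc n) × spar (PARITY (suc n)) ≡ 2
parity-depth-rank-sparsity n =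
  ((T , parityTree-computes (suc n) , depth-parityTree (allFin (suc n)) false) ,
     λ t t-computes → ≤-trans (rank-parity t t-computes) (rank≤depth t)) ,
  ((T , parityTree-computes (suc n) , rank-parityTree (allFin (suc n)) false) , rank-parity) ,
  spar-parity n
  where T = parityTree (allFin (suc n)) false

theorem5p2 : (∀ (n : ℕ) (f : BoolFun n) (d r : ℕ) → IsDepth f d → IsRank f r →
                 2 ^ d ≤ 2 ^ r * spar f ^ r)
             × (∀ (n : ℕ) → IsDepth (PARITY (suc n)) (suc n)
                            × IsRank (PARITY (suc n)) (suc n)
                            × spar (PARITY (suc n)) ≡ 2)
theorem5p2 = (λ n f d r → depth-rank-sparsity f) , parity-depth-rank-sparsity
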